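{- Let $n\ge 3$ be odd, let $k\ge 1$ be an integer, and let $c$ be an integer with $1\le c<\frac{2n(k+1)}{n-3}$ (no upper bound on $c$ when $n=3$). Let $G_{n,k,c}$ be the unicyclic graph consisting of a cycle $C_n$ with vertices $a_1,a_2,\dots,a_n$ (in cyclic order), together with $k$ pendant vertices attached to each of $a_1,\dots,a_{n-1}$ and $k+c$ pendant vertices attached to $a_n$ (so $G_{n,k,c}$ has $p=q=n(k+1)+c$ vertices and edges). Then $G_{n,k,c}$ is super edge-magic total and $$sm(G_{n,k,c})=2n(k+1)+2c+\frac{n+3}{2}.$$
   Context: All graphs are finite, simple and undirected. For a graph $G$ with $p$ vertices and $q$ edges, a super edge-magic total labeling is a bijection $f\colon V(G)\cup E(G)\to\{1,2,\dots,p+q\}$ with $f(V(G))=\{1,\dots,p\}$ such that $f(u)+f(v)+f(uv)$ equals a constant $c(f)$ (the magic constant) for every edge $uv\in E(G)$. $G$ is super edge-magic total if it admits such a labeling, and its super edge-magic total strength $sm(G)$ is the minimum of $c(f)$ over all super edge-magic total labelings $f$ of $G$. -}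

module Defs where

open import Data.Nat using (ℕ; zero; suc; _+_; _*_; _≤_; _<_; _<?_; s≤s)
open import Data.Fin using (Fin; toℕ; fromℕ; fromℕ<) renaming (zero to fzero)
open import Data.Product using (_×_; _,_; ∃)
open import Data.Sum using (_⊎_; inj₁; inj₂)
open import Function.Bundles using (_⤖_; Bijection)
open import Relation.Binary.PropositionalEquality using (_≡_)
open import Relation.Nullary using (yes; no)

-- Super edge-magic total labeling of a graph with p vertices and q edges:
-- a bijection f : V ⊎ E → {1,…,p+q} (encoded as Fin (p+q), label = toℕ+1)
-- with f(V) = {1,…,p} (vertices get labels ≤ p, edges labels > p), and a
-- constant `const` with f(u)+f(v)+f(uv) = const for every edge uv.
record SEMTLabeling (V E : Set) (ends : E → V × V) (p q : ℕ) : Set where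
  field
    f       : (V ⊎ E) ⤖ Fin (p + q)
  lab : V ⊎ E → ℕ
  lab x = suc (toℕ (Bijection.to f x))
  field
    vertLow : ∀ v → lab (inj₁ v) ≤ p
    edgeHigh : ∀ e → p < lab (inj₂ e)
    const   : ℕ
    magic   : ∀ e → let (u , w) = ends e in
                lab (inj₁ u) + lab (inj₁ w) + lab (inj₂ e) ≡ const

IsSEMT : (V E : Set) (ends : E → V × V) (p q : ℕ) → Set
IsSEMT V E ends p q = SEMTLabeling V E ends p q

IsSM : (V E : Set) (ends : E → V × V) (p q : ℕ) → ℕ → Set
IsSM V E ends p q m =
  (∃ λ (L : SEMTLabeling V E ends p q) → SEMTLabeling.const L ≡ m)
  × (∀ (L : SEMTLabeling V E ends p q) → m ≤ SEMTLabeling.const L)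

-- Cycle vertices a_1,…,a_n are  cyc 0, …, cyc (n-1)  (a_n = cyc (n-1)).
-- Each cycle vertex a_i has k pendants  pend i j  (j < k);
-- a_n additionally has c pendants  xpend j  (j < c), so k+c in total.

data GV (n k c : ℕ) : Set where
  cyc   : Fin n → GV n k c
  pend  : Fin n → Fin k → GV n k c
  xpend : Fin c → GV n k c

data GE (n k c : ℕ) : Set where
  cycE  : Fin n → GE n k c
  pendE : Fin n → Fin k → GE n k c
  xpendE : Fin c → GE n k c

cnext : ∀ {n} → Fin n → Fin n
cnext {suc m} i with toℕ i <? m
... | yes p = fromℕ< (s≤s p)
... | no _  = fzero

gends : ∀ n k c → GE n k c → GV n k c × GV n k c
gends n k c (cycE i)    = cyc i , cyc (cnext i)
gends n k c (pendE i j) = cyc i , pend i j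
gends (suc m) k c (xpendE j) = cyc (fromℕ m) , xpend j
gends zero    k c (xpendE j) = xpend j , xpend j   -- junk: n = 0 never used

-- Sum the magic condition over all S = n(k + 1) + c edges. Every edge owns one of its ends (a_i owns
-- a_i a_{i+1}, a pendant vertex owns its edge), so each vertex is counted once as an owned end; the other
-- ends are cycle vertices, each counted k + 1 times and a_n another c times. As all labels are distinct,
-- S K ≥ (1 + ⋯ + 2S) + (k + 1)(1 + ⋯ + n) + c, which forces K ≥ 2S + (n + 3)/2 when (n − 3)c < 2n(k + 1).
-- Conversely, label the cycle by the classical edge-magic labeling of C_n (a_{2j+1} ↦ j + 1,
-- a_{2j+2} ↦ (n + 3)/2 + j), the r-th pendant of a_i by (label of a_{i+1}) + r n, the extra pendants of
-- a_n by n(k + 1) + 1, …, S, and the edges S + 1, …, 2S in the order that makes every edge sum equal to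
-- 2S + (n + 3)/2.

module Submission where

open import Defs
open import Data.Nat using (ℕ; zero; suc; _+_; _*_; _∸_; _≤_; _<_; _/_; _%_; _≤?_; _<?_; z≤n; s≤s; z<s; NonZero)
open import Data.Nat.Properties
open import Data.Nat.DivMod using ([m+kn]%n≡m%n; m<n⇒m%n≡m; m≡m%n+[m/n]*n; m*n/n≡m)
open import Data.Nat.Tactic.RingSolver using (solve-∀)
open import Algebra.Properties.CommutativeSemigroup +-commutativeSemigroup using (xy∙z≈xz∙y)
open import Algebra.Properties.Semiring.Sum +-*-semiring
  using (sum; sum-cong-≗; sum-remove; ∑-distrib-+; *-distribˡ-sum)
open import Data.Fin using (Fin; toℕ; fromℕ; fromℕ<; splitAt; join; combine; remQuot; punchOut)
  renaming (zero to fzero; suc to fsuc)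
open import Data.Fin.Properties as Fin
  using (join-splitAt; combine-remQuot; any?; punchIn-injective; punchOut-injective; injective⇒≤; <⇒notInjective)
open import Data.Vec.Functional using (Vector; _++_; concat; removeAt)
open import Data.Product using (_×_; _,_; ∃; proj₁; proj₂; uncurry)
open import Data.Sum using (_⊎_; inj₁; inj₂; [_,_]′)
open import Data.Sum.Properties using ([,]-∘; [,]-map; inj₁-injective; inj₂-injective)
open import Data.Empty using (⊥-elim)
open import Function using (_∘_; flip)
open import Function.Definitions using (Injective)
open import Function.Bundles using (_⤖_; mk⤖; Bijection)
open import Relation.Nullary using (yes; no; contradiction)
open import Relation.Binary.PropositionalEquality

sum-const : ∀ m x → sum {m} (λ _ → x) ≡ m * x
sum-const zero    x = refl
sum-const (suc m) x = cong (x +_) (sum-const m x)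

sum-∘-++ : ∀ {A : Set} {m n} (g : A → ℕ) (xs : Vector A m) (ys : Vector A n) →
           sum (g ∘ (xs ++ ys)) ≡ sum (g ∘ xs) + sum (g ∘ ys)
sum-∘-++ {m = zero}  g xs ys = refl
sum-∘-++ {m = suc m} g xs ys = begin
  g (xs fzero) + sum (g ∘ (xs ++ ys) ∘ fsuc)
    ≡⟨ cong (g (xs fzero) +_) (sum-cong-≗ (λ i → cong g ([,]-map (splitAt m i)))) ⟩
  g (xs fzero) + sum (g ∘ (xs ∘ fsuc ++ ys))
    ≡⟨ cong (g (xs fzero) +_) (sum-∘-++ g (xs ∘ fsuc) ys) ⟩
  g (xs fzero) + (sum (g ∘ xs ∘ fsuc) + sum (g ∘ ys))
    ≡⟨ +-assoc (g (xs fzero)) _ _ ⟨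
  sum (g ∘ xs) + sum (g ∘ ys) ∎
  where open ≡-Reasoning

concat-suc : ∀ {A : Set} {m n} (xss : Vector (Vector A m) (suc n)) → concat xss ≗ xss fzero ++ concat (xss ∘ fsuc)
concat-suc {m = m} xss i = [,]-∘ (uncurry (flip xss)) (splitAt m i)

sum-∘-concat : ∀ {A : Set} {m n} (g : A → ℕ) (xss : Vector (Vector A m) n) →
               sum (g ∘ concat xss) ≡ sum (λ i → sum (g ∘ xss i))
sum-∘-concat {n = zero}  g xss = refl
sum-∘-concat {n = suc n} g xss = begin
  sum (g ∘ concat xss)                              ≡⟨ sum-cong-≗ (cong g ∘ concat-suc xss) ⟩
  sum (g ∘ (xss fzero ++ concat (xss ∘ fsuc)))      ≡⟨ sum-∘-++ g (xss fzero) _ ⟩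
  sum (g ∘ xss fzero) + sum (g ∘ concat (xss ∘ fsuc)) ≡⟨ cong (sum (g ∘ xss fzero) +_) (sum-∘-concat g (xss ∘ fsuc)) ⟩
  sum (λ i → sum (g ∘ xss i))                       ∎
  where open ≡-Reasoning

injective-++ : ∀ {A : Set} {m n} {xs : Vector A m} {ys : Vector A n} →
               Injective _≡_ _≡_ xs → Injective _≡_ _≡_ ys → (∀ i j → xs i ≢ ys j) → Injective _≡_ _≡_ (xs ++ ys)
injective-++ {m = m} {n = n} {xs} {ys} xs-injective ys-injective disjoint {i} {j} eq = begin
  i                     ≡⟨ join-splitAt m n i ⟨
  join m n (splitAt m i) ≡⟨ cong (join m n) (split-injective (splitAt m i) (splitAt m j) eq) ⟩
  join m n (splitAt m j) ≡⟨ join-splitAt m n j ⟩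
  j                     ∎
  where
  open ≡-Reasoning
  split-injective : ∀ s t → [ xs , ys ]′ s ≡ [ xs , ys ]′ t → s ≡ t
  split-injective (inj₁ a) (inj₁ b) e = cong inj₁ (xs-injective e)
  split-injective (inj₁ a) (inj₂ b) e = contradiction e (disjoint a b)
  split-injective (inj₂ a) (inj₁ b) e = contradiction (sym e) (disjoint b a)
  split-injective (inj₂ a) (inj₂ b) e = cong inj₂ (ys-injective e)

injective-concat : ∀ {A : Set} {m n} {xss : Vector (Vector A m) n} →
                   (∀ {i j i′ j′} → xss i j ≡ xss i′ j′ → i ≡ i′ × j ≡ j′) →
                   Injective _≡_ _≡_ (concat xss)
injective-concat {m = m} {n = n} xss-injective {i} {j} eq with xss-injective eq
... | q≡q′ , r≡r′ = begin
  i                              ≡⟨ combine-remQuot {n} m i ⟨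
  combine (quot i) (rem i)       ≡⟨ cong₂ combine q≡q′ r≡r′ ⟩
  combine (quot j) (rem j)       ≡⟨ combine-remQuot {n} m j ⟩
  j                              ∎
  where
  open ≡-Reasoning
  quot = proj₁ ∘ remQuot {n} m
  rem  = proj₂ ∘ remQuot {n} m

injective⇒∃≥ : ∀ {m} {h : Fin (suc m) → ℕ} → Injective _≡_ _≡_ h → ∃ λ i → m ≤ h i
injective⇒∃≥ {m} {h} h-injective with any? (λ i → m ≤? h i)
... | yes found = found
... | no none = ⊥-elim (<⇒notInjective ≤-refl squeezed-injective)
  where
  h<m : ∀ i → h i < m
  h<m i = ≰⇒> (λ m≤hi → none (i , m≤hi))
  squeezed-injective : Injective _≡_ _≡_ (λ i → fromℕ< (h<m i))
  squeezed-injective {i} {j} e = h-injective (begin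
    h i                  ≡⟨ Fin.toℕ-fromℕ< (h<m i) ⟨
    toℕ (fromℕ< (h<m i)) ≡⟨ cong toℕ e ⟩
    toℕ (fromℕ< (h<m j)) ≡⟨ Fin.toℕ-fromℕ< (h<m j) ⟩
    h j                  ∎)
    where open ≡-Reasoning

sum-suc-injective-≥ : ∀ {m} (h : Fin m → ℕ) → Injective _≡_ _≡_ h → m * suc m ≤ 2 * sum (λ i → suc (h i))
sum-suc-injective-≥ {zero}  h h-injective = z≤n
sum-suc-injective-≥ {suc m} h h-injective with injective⇒∃≥ h-injective
... | i , m≤hi = begin
  suc m * suc (suc m)                          ≡⟨ triangle-step m ⟩
  2 * suc m + m * suc m                        ≤⟨ +-mono-≤ (*-monoʳ-≤ 2 (s≤s m≤hi)) rest-≥ ⟩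
  2 * suc (h i) + 2 * sum (suc ∘ removeAt h i) ≡⟨ *-distribˡ-+ 2 (suc (h i)) _ ⟨
  2 * (suc (h i) + sum (suc ∘ removeAt h i))   ≡⟨ cong (2 *_) (sum-remove {i = i} (suc ∘ h)) ⟨
  2 * sum (λ j → suc (h j))                    ∎
  where
  open ≤-Reasoning
  triangle-step : ∀ m → suc m * suc (suc m) ≡ 2 * suc m + m * suc m
  triangle-step = solve-∀
  rest-≥ : m * suc m ≤ 2 * sum (suc ∘ removeAt h i)
  rest-≥ = sum-suc-injective-≥ (removeAt h i) (punchIn-injective i _ _ ∘ h-injective)

injective⇒surjective : ∀ {m n} {f : Fin m → Fin n} → n ≤ m → Injective _≡_ _≡_ f →
                       ∀ y → ∃ λ x → f x ≡ y
injective⇒surjective {f = f} n≤m f-injective y with any? (λ x → f x Fin.≟ y)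
... | yes found = found
injective⇒surjective {m} {suc n} {f} n≤m f-injective y | no missed =
  contradiction (≤-trans n≤m (injective⇒≤ punched-injective)) (n≮n n)
  where
  y≢f : ∀ x → y ≢ f x
  y≢f x e = missed (x , sym e)
  punched-injective : Injective _≡_ _≡_ (λ x → punchOut (y≢f x))
  punched-injective e = f-injective (punchOut-injective (y≢f _) (y≢f _) e)

injective⇒⤖ : ∀ {A : Set} {m n} (elements : Fin m → A) → Injective _≡_ _≡_ elements →
              (g : A → Fin n) → Injective _≡_ _≡_ g → n ≤ m → A ⤖ Fin n
injective⇒⤖ elements elements-injective g g-injective n≤m = mk⤖ (g-injective , surjective)
  where
  surjective : ∀ y → ∃ λ x → ∀ {z} → z ≡ x → g z ≡ y
  surjective y with injective⇒surjective n≤m (elements-injective ∘ g-injective) y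
  ... | x , gx≡y = elements x , λ { refl → gx≡y }

divMod-unique : ∀ {n r r′ b b′} .{{_ : NonZero n}} → b < n → b′ < n →
                b + r * n ≡ b′ + r′ * n → b ≡ b′ × r ≡ r′
divMod-unique {n} {r} {r′} {b} {b′} b<n b′<n eq = b≡b′ , *-cancelʳ-≡ r r′ n (+-cancelˡ-≡ b _ _ rn-eq)
  where
  open ≡-Reasoning
  b≡b′ : b ≡ b′
  b≡b′ = begin
    b                ≡⟨ m<n⇒m%n≡m b<n ⟨
    b % n            ≡⟨ [m+kn]%n≡m%n b r n ⟨
    (b + r * n) % n  ≡⟨ cong (_% n) eq ⟩
    (b′ + r′ * n) % n ≡⟨ [m+kn]%n≡m%n b′ r′ n ⟩
    b′ % n           ≡⟨ m<n⇒m%n≡m b′<n ⟩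
    b′               ∎
  rn-eq : b + r * n ≡ b + r′ * n
  rn-eq = trans eq (cong (_+ r′ * n) (sym b≡b′))

module CodedLabeling
  {V E : Set} {ends : E → V × V} {p q m : ℕ}
  (elements : Fin m → V ⊎ E) (elements-injective : Injective _≡_ _≡_ elements) (p+q≤m : p + q ≤ m)
  (vertexCode : V → ℕ) (vertexCode-injective : Injective _≡_ _≡_ vertexCode) (vertexCode<p : ∀ v → vertexCode v < p)
  (edgeCode : E → ℕ) (edgeCode-injective : Injective _≡_ _≡_ edgeCode) (edgeCode<q : ∀ e → edgeCode e < q)
  (s : ℕ) (ends-sum : ∀ e → vertexCode (proj₁ (ends e)) + vertexCode (proj₂ (ends e)) ≡ s + edgeCode e)
  where

  -- Edge codes decrease as edgeCode increases, so that code (inj₂ e) + edgeCode e is constant.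
  code : V ⊎ E → ℕ
  code (inj₁ v) = vertexCode v
  code (inj₂ e) = p + (q ∸ suc (edgeCode e))

  code<p+q : ∀ x → code x < p + q
  code<p+q (inj₁ v) = ≤-trans (vertexCode<p v) (m≤m+n p q)
  code<p+q (inj₂ e) = +-monoʳ-< p (∸-monoʳ-< z<s (edgeCode<q e))

  code-injective : Injective _≡_ _≡_ code
  code-injective {inj₁ v} {inj₁ w} eq = cong inj₁ (vertexCode-injective eq)
  code-injective {inj₁ v} {inj₂ e} eq = contradiction eq (<⇒≢ (≤-trans (vertexCode<p v) (m≤m+n p _)))
  code-injective {inj₂ e} {inj₁ v} eq = contradiction eq (>⇒≢ (≤-trans (vertexCode<p v) (m≤m+n p _)))
  code-injective {inj₂ e} {inj₂ e′} eq = cong inj₂ (edgeCode-injective (suc-injective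
    (∸-cancelˡ-≡ (edgeCode<q e) (edgeCode<q e′) (+-cancelˡ-≡ p _ _ eq))))

  label : V ⊎ E → Fin (p + q)
  label x = fromℕ< (code<p+q x)

  toℕ-label : ∀ x → toℕ (label x) ≡ code x
  toℕ-label x = Fin.toℕ-fromℕ< (code<p+q x)

  label-injective : Injective _≡_ _≡_ label
  label-injective {x} {y} eq = code-injective (trans (sym (toℕ-label x)) (trans (cong toℕ eq) (toℕ-label y)))

  labeling : SEMTLabeling V E ends p q
  labeling = record
    { f        = injective⇒⤖ elements elements-injective label label-injective p+q≤m
    ; vertLow  = λ v → subst (_≤ p) (cong suc (sym (toℕ-label (inj₁ v)))) (vertexCode<p v)
    ; edgeHigh = λ e → s≤s (subst (p ≤_) (sym (toℕ-label (inj₂ e))) (m≤m+n p _))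
    ; const    = p + q + s + 2
    ; magic    = magic
    }
    where
    magic : ∀ e → suc (toℕ (label (inj₁ (proj₁ (ends e))))) + suc (toℕ (label (inj₁ (proj₂ (ends e)))))
                  + suc (toℕ (label (inj₂ e))) ≡ p + q + s + 2
    magic e
      rewrite toℕ-label (inj₁ (proj₁ (ends e))) | toℕ-label (inj₁ (proj₂ (ends e))) | toℕ-label (inj₂ e) = begin
      suc (vertexCode u) + suc (vertexCode w) + suc (p + d) ≡⟨ regroup (vertexCode u) (vertexCode w) p d ⟩
      suc (suc (vertexCode u + vertexCode w)) + suc (p + d) ≡⟨ cong (λ x → suc (suc x) + suc (p + d)) (ends-sum e) ⟩
      suc (suc (s + edgeCode e)) + suc (p + d)              ≡⟨ regroup′ s (edgeCode e) p d ⟩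
      p + (d + suc (edgeCode e)) + s + 2                    ≡⟨ cong (λ x → p + x + s + 2) (m∸n+n≡m (edgeCode<q e)) ⟩
      p + q + s + 2                                         ∎
      where
      open ≡-Reasoning
      u = proj₁ (ends e)
      w = proj₂ (ends e)
      d = q ∸ suc (edgeCode e)
      regroup : ∀ a b p d → suc a + suc b + suc (p + d) ≡ suc (suc (a + b)) + suc (p + d)
      regroup = solve-∀
      regroup′ : ∀ s σ p d → suc (suc (s + σ)) + suc (p + d) ≡ p + (d + suc σ) + s + 2
      regroup′ = solve-∀

toℕ-cnext : ∀ {m} (i : Fin (suc m)) →
            toℕ i < m × toℕ (cnext i) ≡ suc (toℕ i) ⊎ toℕ i ≡ m × toℕ (cnext i) ≡ 0
toℕ-cnext {m} i with toℕ i <? m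
... | yes i<m = inj₁ (i<m , Fin.toℕ-fromℕ< (s≤s i<m))
... | no  i≮m = inj₂ (≤-antisym (≤-pred (Fin.toℕ<n i)) (≮⇒≥ i≮m) , refl)

cnext-injective : ∀ {m} → Injective _≡_ _≡_ (cnext {suc m})
cnext-injective {m} {i} {j} eq = Fin.toℕ-injective (cases (toℕ-cnext i) (toℕ-cnext j))
  where
  eq′ = cong toℕ eq
  cases : _ → _ → toℕ i ≡ toℕ j
  cases (inj₁ (_ , ci)) (inj₁ (_ , cj)) = suc-injective (trans (sym ci) (trans eq′ cj))
  cases (inj₁ (_ , ci)) (inj₂ (_ , cj)) with () ← trans (sym ci) (trans eq′ cj)
  cases (inj₂ (_ , ci)) (inj₁ (_ , cj)) with () ← trans (sym cj) (trans (sym eq′) ci)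
  cases (inj₂ (i≡m , _)) (inj₂ (j≡m , _)) = trans i≡m (sym j≡m)

module Enumeration (n k c : ℕ) where

  own : GE n k c → GV n k c
  own (cycE i)    = cyc i
  own (pendE i j) = pend i j
  own (xpendE j)  = xpend j

  own-injective : Injective _≡_ _≡_ own
  own-injective {cycE i}    {cycE .i}    refl = refl
  own-injective {pendE i j} {pendE .i .j} refl = refl
  own-injective {xpendE j}  {xpendE .j}  refl = refl

  size : ℕ
  size = n + (n * k + c)

  edgeAt : Vector (GE n k c) size
  edgeAt = cycE ++ (concat pendE ++ xpendE)

  edgeAt-injective : Injective _≡_ _≡_ edgeAt
  edgeAt-injective = injective-++ {xs = cycE} (λ { refl → refl }) pendant-injective cycE∉pendant
    where
    pendant-injective : Injective _≡_ _≡_ (concat pendE ++ xpendE)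
    pendant-injective = injective-++ {xs = concat pendE} {ys = xpendE}
      (injective-concat {xss = pendE} λ { refl → refl , refl }) (λ { refl → refl }) λ _ _ ()
    cycE∉pendant : ∀ i j → cycE i ≢ (concat pendE ++ xpendE) j
    cycE∉pendant i j = cycE∉ (splitAt (n * k) j)
      where
      cycE∉ : ∀ s → cycE i ≢ [ concat pendE , xpendE ]′ s
      cycE∉ (inj₁ _) ()
      cycE∉ (inj₂ _) ()

  elementAt : Vector (GV n k c ⊎ GE n k c) (size + size)
  elementAt = (inj₁ ∘ own ∘ edgeAt) ++ (inj₂ ∘ edgeAt)

  elementAt-injective : Injective _≡_ _≡_ elementAt
  elementAt-injective = injective-++ {xs = inj₁ ∘ own ∘ edgeAt} {ys = inj₂ ∘ edgeAt}
    (λ e → edgeAt-injective (own-injective (inj₁-injective e))) (λ e → edgeAt-injective (inj₂-injective e)) λ _ _ ()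

module LowerBound (n′ k c : ℕ) where

  n : ℕ
  n = suc n′

  open Enumeration n k c

  other : GE n k c → GV n k c
  other (cycE i)    = cyc (cnext i)
  other (pendE i j) = cyc i
  other (xpendE j)  = cyc (fromℕ n′)

  ends-sum≡own+other : (w : GV n k c → ℕ) → ∀ e →
                       w (proj₁ (gends n k c e)) + w (proj₂ (gends n k c e)) ≡ w (own e) + w (other e)
  ends-sum≡own+other w (cycE i)    = refl
  ends-sum≡own+other w (pendE i j) = +-comm (w (cyc i)) (w (pend i j))
  ends-sum≡own+other w (xpendE j)  = +-comm (w (cyc (fromℕ n′))) (w (xpend j))

  module _ {p q : ℕ} (L : SEMTLabeling (GV n k c) (GE n k c) (gends n k c) p q) where
    open SEMTLabeling L

    weight : GV n k c → ℕ
    weight v = lab (inj₁ v)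

    code : GV n k c ⊎ GE n k c → ℕ
    code = toℕ ∘ Bijection.to f

    code-injective : Injective _≡_ _≡_ code
    code-injective = Bijection.injective f ∘ Fin.toℕ-injective

    magic-own-other : ∀ e → weight (own e) + lab (inj₂ e) + weight (other e) ≡ const
    magic-own-other e = begin
      weight (own e) + lab (inj₂ e) + weight (other e)                    ≡⟨ xy∙z≈xz∙y (weight (own e)) _ _ ⟩
      weight (own e) + weight (other e) + lab (inj₂ e)                    ≡⟨ cong (_+ lab (inj₂ e)) (ends-sum≡own+other weight e) ⟨
      weight (proj₁ (gends n k c e)) + weight (proj₂ (gends n k c e)) + lab (inj₂ e) ≡⟨ magic e ⟩
      const                                                               ∎
      where open ≡-Reasoning

    elementSum otherSum : ℕ
    elementSum = sum (lab ∘ elementAt)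
    otherSum   = sum (weight ∘ other ∘ edgeAt)

    size*const≡ : size * const ≡ elementSum + otherSum
    size*const≡ = begin
      size * const
        ≡⟨ sum-const size const ⟨
      sum {size} (λ _ → const)
        ≡⟨ sum-cong-≗ (λ i → magic-own-other (edgeAt i)) ⟨
      sum (λ i → weight (own (edgeAt i)) + lab (inj₂ (edgeAt i)) + weight (other (edgeAt i)))
        ≡⟨ ∑-distrib-+ (λ i → weight (own (edgeAt i)) + lab (inj₂ (edgeAt i))) (weight ∘ other ∘ edgeAt) ⟩
      sum (λ i → weight (own (edgeAt i)) + lab (inj₂ (edgeAt i))) + otherSum
        ≡⟨ cong (_+ otherSum) (∑-distrib-+ (weight ∘ own ∘ edgeAt) (lab ∘ inj₂ ∘ edgeAt)) ⟩
      sum (weight ∘ own ∘ edgeAt) + sum (lab ∘ inj₂ ∘ edgeAt) + otherSum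
        ≡⟨ cong (_+ otherSum) (sum-∘-++ lab (inj₁ ∘ own ∘ edgeAt) (inj₂ ∘ edgeAt)) ⟨
      elementSum + otherSum
        ∎
      where open ≡-Reasoning

    elementSum-≥ : (size + size) * suc (size + size) ≤ 2 * elementSum
    elementSum-≥ = sum-suc-injective-≥ (code ∘ elementAt) (elementAt-injective ∘ code-injective)

    otherSum≡ : otherSum ≡ sum (weight ∘ cyc ∘ cnext) + (k * sum (weight ∘ cyc) + c * weight (cyc (fromℕ n′)))
    otherSum≡ = begin
      otherSum
        ≡⟨ sum-∘-++ (weight ∘ other) cycE (concat pendE ++ xpendE) ⟩
      sum (weight ∘ cyc ∘ cnext) + sum (weight ∘ other ∘ (concat pendE ++ xpendE))
        ≡⟨ cong (sum (weight ∘ cyc ∘ cnext) +_) (begin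
             sum (weight ∘ other ∘ (concat pendE ++ xpendE))
               ≡⟨ sum-∘-++ (weight ∘ other) (concat pendE) xpendE ⟩
             sum (weight ∘ other ∘ concat pendE) + sum {c} (λ _ → weight (cyc (fromℕ n′)))
               ≡⟨ cong₂ _+_ (sum-∘-concat (weight ∘ other) pendE) (sum-const c (weight (cyc (fromℕ n′)))) ⟩
             sum (λ i → sum {k} (λ _ → weight (cyc i))) + c * weight (cyc (fromℕ n′))
               ≡⟨ cong (_+ c * weight (cyc (fromℕ n′))) (sum-cong-≗ (λ i → sum-const k (weight (cyc i)))) ⟩
             sum (λ i → k * weight (cyc i)) + c * weight (cyc (fromℕ n′))
               ≡⟨ cong (_+ c * weight (cyc (fromℕ n′))) (*-distribˡ-sum k (weight ∘ cyc)) ⟨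
             k * sum (weight ∘ cyc) + c * weight (cyc (fromℕ n′)) ∎) ⟩
      sum (weight ∘ cyc ∘ cnext) + (k * sum (weight ∘ cyc) + c * weight (cyc (fromℕ n′)))
        ∎
      where open ≡-Reasoning

    otherSum-≥ : n * suc n + k * (n * suc n) + 2 * c ≤ 2 * otherSum
    otherSum-≥ = begin
      n * suc n + k * (n * suc n) + 2 * c
        ≤⟨ +-mono-≤ (+-mono-≤ next-≥ (*-monoʳ-≤ k cycle-≥)) (*-monoʳ-≤ 2 (m≤m*n c (weight (cyc (fromℕ n′))))) ⟩
      2 * A + k * (2 * B) + 2 * (c * x)
        ≡⟨ distribute A B k c x ⟩
      2 * (A + (k * B + c * x))
        ≡⟨ cong (2 *_) otherSum≡ ⟨
      2 * otherSum
        ∎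
      where
      open ≤-Reasoning
      A = sum (weight ∘ cyc ∘ cnext)
      B = sum (weight ∘ cyc)
      x = weight (cyc (fromℕ n′))
      cyc-injective : Injective _≡_ _≡_ (cyc {n} {k} {c})
      cyc-injective refl = refl
      next-≥ : n * suc n ≤ 2 * A
      next-≥ = sum-suc-injective-≥ (code ∘ inj₁ ∘ cyc ∘ cnext)
                 (cnext-injective ∘ cyc-injective ∘ inj₁-injective ∘ code-injective)
      cycle-≥ : n * suc n ≤ 2 * B
      cycle-≥ = sum-suc-injective-≥ (code ∘ inj₁ ∘ cyc) (cyc-injective ∘ inj₁-injective ∘ code-injective)
      distribute : ∀ A B k c x → 2 * A + k * (2 * B) + 2 * (c * x) ≡ 2 * (A + (k * B + c * x))
      distribute = solve-∀

    countingBound : (size + size) * suc (size + size) + (n * suc n + k * (n * suc n) + 2 * c) ≤ 2 * (size * const)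
    countingBound = begin
      (size + size) * suc (size + size) + (n * suc n + k * (n * suc n) + 2 * c)
        ≤⟨ +-mono-≤ elementSum-≥ otherSum-≥ ⟩
      2 * elementSum + 2 * otherSum ≡⟨ *-distribˡ-+ 2 elementSum otherSum ⟨
      2 * (elementSum + otherSum)   ≡⟨ cong (2 *_) size*const≡ ⟨
      2 * (size * const)            ∎
      where open ≤-Reasoning

even-or-odd : ∀ i → ∃ λ j → i ≡ j * 2 ⊎ i ≡ suc (j * 2)
even-or-odd zero          = 0 , inj₁ refl
even-or-odd (suc zero)    = 0 , inj₂ refl
even-or-odd (suc (suc i)) with even-or-odd i
... | j , inj₁ refl = suc j , inj₁ refl
... | j , inj₂ refl = suc j , inj₂ refl

module OddCycle (h : ℕ) where

  n : ℕ
  n = suc (h * 2)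

  -- The classical edge-magic labeling of C_n, shifted to start at 0: a_{2j+1} ↦ j, a_{2j+2} ↦ h + 1 + j.
  ℓ : ℕ → ℕ
  ℓ zero          = zero
  ℓ (suc zero)    = suc h
  ℓ (suc (suc i)) = suc (ℓ i)

  ℓ-even : ∀ j → ℓ (j * 2) ≡ j
  ℓ-even zero    = refl
  ℓ-even (suc j) = cong suc (ℓ-even j)

  ℓ-odd : ∀ j → ℓ (suc (j * 2)) ≡ suc (h + j)
  ℓ-odd zero    = cong suc (sym (+-identityʳ h))
  ℓ-odd (suc j) = cong suc (trans (ℓ-odd j) (sym (+-suc h j)))

  ℓ-adjacent : ∀ i → ℓ i + ℓ (suc i) ≡ h + suc i
  ℓ-adjacent zero          = sym (+-comm h 1)
  ℓ-adjacent (suc zero)    = sym (+-suc h 1)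
  ℓ-adjacent (suc (suc i)) = begin
    suc (ℓ i) + suc (ℓ (suc i)) ≡⟨ cong suc (+-suc (ℓ i) (ℓ (suc i))) ⟩
    suc (suc (ℓ i + ℓ (suc i))) ≡⟨ cong (suc ∘ suc) (ℓ-adjacent i) ⟩
    suc (suc (h + suc i))       ≡⟨ cong suc (+-suc h (suc i)) ⟨
    suc (h + suc (suc i))       ≡⟨ +-suc h (suc (suc i)) ⟨
    h + suc (suc (suc i))       ∎
    where open ≡-Reasoning

  even<n⇒≤h : ∀ {j} → j * 2 < n → j ≤ h
  even<n⇒≤h j*2<n = *-cancelʳ-≤ _ h 2 (≤-pred j*2<n)

  odd<n⇒<h : ∀ {j} → suc (j * 2) < n → j < h
  odd<n⇒<h j*2+1<n = *-cancelʳ-< 2 _ h (≤-pred j*2+1<n)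

  ℓ<n : ∀ {i} → i < n → ℓ i < n
  ℓ<n {i} i<n with even-or-odd i
  ... | j , inj₁ refl rewrite ℓ-even j = s≤s (≤-trans (even<n⇒≤h i<n) (m≤m*n h 2))
  ... | j , inj₂ refl rewrite ℓ-odd j = s≤s (begin
    suc (h + j) ≡⟨ +-suc h j ⟨
    h + suc j   ≤⟨ +-monoʳ-≤ h (odd<n⇒<h i<n) ⟩
    h + h       ≡⟨ cong (h +_) (*-identityʳ h) ⟨
    h + h * 1   ≡⟨ *-suc h 1 ⟨
    h * 2       ∎)
    where open ≤-Reasoning

  ℓ-injective : ∀ {i i′} → i < n → i′ < n → ℓ i ≡ ℓ i′ → i ≡ i′
  ℓ-injective {i} {i′} i<n i′<n eq with even-or-odd i | even-or-odd i′
  ... | j , inj₁ refl | j′ , inj₁ refl = cong (_* 2) (trans (sym (ℓ-even j)) (trans eq (ℓ-even j′)))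
  ... | j , inj₂ refl | j′ , inj₂ refl =
    cong (suc ∘ (_* 2)) (+-cancelˡ-≡ h _ _ (suc-injective (trans (sym (ℓ-odd j)) (trans eq (ℓ-odd j′)))))
  ... | j , inj₁ refl | j′ , inj₂ refl =
    contradiction (trans (sym (ℓ-even j)) (trans eq (ℓ-odd j′)))
                  (<⇒≢ (s≤s (≤-trans (even<n⇒≤h i<n) (m≤m+n h j′))))
  ... | j , inj₂ refl | j′ , inj₁ refl =
    contradiction (trans (sym (ℓ-even j′)) (trans (sym eq) (ℓ-odd j)))
                  (<⇒≢ (s≤s (≤-trans (even<n⇒≤h i′<n) (m≤m+n h j))))

  label : Fin n → ℕ
  label i = ℓ (toℕ i)

  label<n : ∀ i → label i < n
  label<n i = ℓ<n (Fin.toℕ<n i)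

  label-injective : Injective _≡_ _≡_ label
  label-injective eq = Fin.toℕ-injective (ℓ-injective (Fin.toℕ<n _) (Fin.toℕ<n _) eq)

  label-last : label (fromℕ (h * 2)) ≡ h
  label-last = trans (cong ℓ (Fin.toℕ-fromℕ (h * 2))) (ℓ-even h)

  label-cnext : ∀ i → label i + label (cnext i) ≡ h + toℕ (cnext i)
  label-cnext i with toℕ-cnext i
  ... | inj₁ (_ , next≡) = begin
    ℓ (toℕ i) + ℓ (toℕ (cnext i)) ≡⟨ cong (λ j → ℓ (toℕ i) + ℓ j) next≡ ⟩
    ℓ (toℕ i) + ℓ (suc (toℕ i))   ≡⟨ ℓ-adjacent (toℕ i) ⟩
    h + suc (toℕ i)               ≡⟨ cong (h +_) next≡ ⟨
    h + toℕ (cnext i)             ∎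
    where open ≡-Reasoning
  ... | inj₂ (i≡last , next≡) = begin
    ℓ (toℕ i) + ℓ (toℕ (cnext i)) ≡⟨ cong₂ (λ j j′ → ℓ j + ℓ j′) i≡last next≡ ⟩
    ℓ (h * 2) + 0                 ≡⟨ cong (_+ 0) (ℓ-even h) ⟩
    h + 0                         ≡⟨ cong (h +_) next≡ ⟨
    h + toℕ (cnext i)             ∎
    where open ≡-Reasoning

module Construction (h k c : ℕ) where

  open OddCycle h
  open Enumeration n k c

  N P : ℕ
  N = n * (k + 1)
  P = N + c

  n≤N : n ≤ N
  n≤N = subst (n ≤_) (cong (n *_) (+-comm 1 k)) (m≤m*n n (suc k))

  n≤pendant : ∀ b r → n ≤ b + suc r * n
  n≤pendant b r = ≤-trans (m≤m+n n (r * n)) (m≤n+m _ b)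

  pendant<N : ∀ {b r} → b < n → r < k → b + suc r * n < N
  pendant<N {b} {r} b<n r<k = begin-strict
    b + suc r * n   <⟨ +-monoˡ-< (suc r * n) b<n ⟩
    n + suc r * n   ≤⟨ *-monoˡ-≤ n (s≤s r<k) ⟩
    suc k * n       ≡⟨ *-comm (suc k) n ⟩
    n * suc k       ≡⟨ cong (n *_) (+-comm 1 k) ⟩
    N               ∎
    where open ≤-Reasoning

  blockCode : (Fin n → ℕ) → (Fin n → ℕ) → GV n k c → ℕ
  blockCode α β (cyc i)    = α i
  blockCode α β (pend i r) = β i + suc (toℕ r) * n
  blockCode α β (xpend j)  = N + toℕ j

  module _ {α β : Fin n → ℕ} (α<n : ∀ i → α i < n) (β<n : ∀ i → β i < n) where

    blockCode<P : ∀ v → blockCode α β v < P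
    blockCode<P (cyc i)    = ≤-trans (α<n i) (≤-trans n≤N (m≤m+n N c))
    blockCode<P (pend i r) = ≤-trans (pendant<N (β<n i) (Fin.toℕ<n r)) (m≤m+n N c)
    blockCode<P (xpend j)  = +-monoʳ-< N (Fin.toℕ<n j)

    private
      cyc<xpend : ∀ i x → α i < N + x
      cyc<xpend i x = ≤-trans (α<n i) (≤-trans n≤N (m≤m+n N x))
      cyc<pend : ∀ i j r → α i < β j + suc r * n
      cyc<pend i j r = ≤-trans (α<n i) (n≤pendant (β j) r)
      pend<xpend : ∀ i (r : Fin k) x → β i + suc (toℕ r) * n < N + x
      pend<xpend i r x = ≤-trans (pendant<N (β<n i) (Fin.toℕ<n r)) (m≤m+n N x)

    blockCode-injective : Injective _≡_ _≡_ α → Injective _≡_ _≡_ β → Injective _≡_ _≡_ (blockCode α β)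
    blockCode-injective α-inj β-inj {cyc i}    {cyc i′}    eq = cong cyc (α-inj eq)
    blockCode-injective α-inj β-inj {cyc i}    {pend j r}  eq = contradiction eq (<⇒≢ (cyc<pend i j (toℕ r)))
    blockCode-injective α-inj β-inj {cyc i}    {xpend j}   eq = contradiction eq (<⇒≢ (cyc<xpend i _))
    blockCode-injective α-inj β-inj {pend j r} {cyc i}     eq = contradiction eq (>⇒≢ (cyc<pend i j (toℕ r)))
    blockCode-injective α-inj β-inj {pend i r} {pend i′ r′} eq =
      let b≡b′ , r≡r′ = divMod-unique (β<n i) (β<n i′) eq
      in cong₂ pend (β-inj b≡b′) (Fin.toℕ-injective (suc-injective r≡r′))
    blockCode-injective α-inj β-inj {pend i r} {xpend j}   eq = contradiction eq (<⇒≢ (pend<xpend i r _))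
    blockCode-injective α-inj β-inj {xpend j}  {cyc i}     eq = contradiction eq (>⇒≢ (cyc<xpend i _))
    blockCode-injective α-inj β-inj {xpend j}  {pend i r}  eq = contradiction eq (>⇒≢ (pend<xpend i r _))
    blockCode-injective α-inj β-inj {xpend j}  {xpend j′}  eq = cong xpend (Fin.toℕ-injective (+-cancelˡ-≡ N _ _ eq))

  vertexCode : GV n k c → ℕ
  vertexCode = blockCode label (label ∘ cnext)

  -- vertexCode ∘ own with labels replaced by successor indices, so that by label-cnext the codes
  -- of the two ends of e add up to h + edgeCode e.
  edgeCode : GE n k c → ℕ
  edgeCode = blockCode (toℕ ∘ cnext) (toℕ ∘ cnext) ∘ own

  ends-sum : ∀ e → vertexCode (proj₁ (gends n k c e)) + vertexCode (proj₂ (gends n k c e)) ≡ h + edgeCode e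
  ends-sum (cycE i)    = label-cnext i
  ends-sum (pendE i r) = begin
    label i + (label (cnext i) + suc (toℕ r) * n) ≡⟨ +-assoc (label i) _ _ ⟨
    label i + label (cnext i) + suc (toℕ r) * n   ≡⟨ cong (_+ suc (toℕ r) * n) (label-cnext i) ⟩
    h + toℕ (cnext i) + suc (toℕ r) * n           ≡⟨ +-assoc h _ _ ⟩
    h + (toℕ (cnext i) + suc (toℕ r) * n)         ∎
    where open ≡-Reasoning
  ends-sum (xpendE j)  = cong (_+ (N + toℕ j)) label-last

  P≡size : P ≡ size
  P≡size = expand n k c
    where
    expand : ∀ n k c → n * (k + 1) + c ≡ n + (n * k + c)
    expand = solve-∀

  labeling : SEMTLabeling (GV n k c) (GE n k c) (gends n k c) P P
  labeling = CodedLabeling.labeling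
    elementAt elementAt-injective (≤-reflexive (cong₂ _+_ P≡size P≡size))
    vertexCode (blockCode-injective label<n (label<n ∘ cnext) label-injective (cnext-injective ∘ label-injective))
      (blockCode<P label<n (label<n ∘ cnext))
    edgeCode (own-injective ∘ blockCode-injective next<n next<n next-injective next-injective)
      (blockCode<P next<n next<n ∘ own)
    h ends-sum
    where
    next<n : ∀ i → toℕ (cnext i) < n
    next<n i = Fin.toℕ<n (cnext i)
    next-injective : Injective _≡_ _≡_ (toℕ ∘ cnext {n})
    next-injective = cnext-injective ∘ Fin.toℕ-injective

odd⇒≡3+a*2 : ∀ {n} → 3 ≤ n → n % 2 ≡ 1 → ∃ λ a → n ≡ 3 + a * 2
odd⇒≡3+a*2 {n} 3≤n n-odd with n / 2 | m≡m%n+[m/n]*n n 2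
... | zero  | n≡n%2 = contradiction (≤-trans 3≤n (≤-reflexive (trans n≡n%2 (cong (_+ 0) n-odd)))) λ { (s≤s ()) }
... | suc a | n≡    = a , trans n≡ (cong (_+ suc a * 2) n-odd)

[n+3]/2 : ∀ a → (3 + a * 2 + 3) / 2 ≡ 3 + a
[n+3]/2 a = trans (cong (_/ 2) (double a)) (m*n/n≡m (3 + a) 2)
  where
  double : ∀ a → 3 + a * 2 + 3 ≡ (3 + a) * 2
  double = solve-∀

-- Writing S for the number of edges and N = n (k + 1), the lower bound exceeds 2 S (2 S + a + 2) by
-- 2 N − 2 a c > 0, which is exactly the hypothesis on c.
countingBound⇒const-≥ : ∀ a k c K → let n = 3 + a * 2; S = n + (n * k + c) in
  a * 2 * c < 2 * n * (k + 1) →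
  (S + S) * suc (S + S) + (n * suc n + k * (n * suc n) + 2 * c) ≤ 2 * (S * K) →
  2 * n * (k + 1) + 2 * c + (3 + a) ≤ K
countingBound⇒const-≥ a k c K c-small lower = ≮⇒≥ λ K<X → <⇒≱ c-small (+-cancelˡ-≤ Z _ _ (begin
  Z + 2 * n * (k + 1)                                                    ≡⟨ lower≡ a k c ⟨
  (S + S) * suc (S + S) + (n * suc n + k * (n * suc n) + 2 * c)          ≤⟨ lower ⟩
  2 * (S * K)                                                            ≤⟨ *-monoʳ-≤ 2 (*-monoʳ-≤ S (K≤Y K<X)) ⟩
  2 * (S * (2 * n * (k + 1) + 2 * c + (2 + a)))                          ≡⟨ upper≡ a k c ⟩
  Z + a * 2 * c                                                          ∎))
  where
  open ≤-Reasoning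
  n = 3 + a * 2
  S = n + (n * k + c)
  Z = 4 * S * S + 4 * (n * (k + 1)) + 2 * a * (n * (k + 1)) + 4 * c
  K≤Y : K < 2 * n * (k + 1) + 2 * c + (3 + a) → K ≤ 2 * n * (k + 1) + 2 * c + (2 + a)
  K≤Y K<X = ≤-pred (subst (suc K ≤_) (+-suc (2 * n * (k + 1) + 2 * c) (2 + a)) K<X)
  lower≡ : ∀ a k c → let n = 3 + a * 2; S = n + (n * k + c) in
    (S + S) * suc (S + S) + (n * suc n + k * (n * suc n) + 2 * c)
      ≡ 4 * S * S + 4 * (n * (k + 1)) + 2 * a * (n * (k + 1)) + 4 * c + 2 * n * (k + 1)
  lower≡ = solve-∀
  upper≡ : ∀ a k c → let n = 3 + a * 2; S = n + (n * k + c) in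
    2 * (S * (2 * n * (k + 1) + 2 * c + (2 + a)))
      ≡ 4 * S * S + 4 * (n * (k + 1)) + 2 * a * (n * (k + 1)) + 4 * c + a * 2 * c
  upper≡ = solve-∀

theorem2p1 : ∀ (n k c : ℕ) → 3 ≤ n → n % 2 ≡ 1 → 1 ≤ k → 1 ≤ c
    → (n ∸ 3) * c < 2 * n * (k + 1)
    → IsSEMT (GV n k c) (GE n k c) (gends n k c) (n * (k + 1) + c) (n * (k + 1) + c)
      × IsSM (GV n k c) (GE n k c) (gends n k c) (n * (k + 1) + c) (n * (k + 1) + c)
          (2 * n * (k + 1) + 2 * c + (n + 3) / 2)
theorem2p1 n k c 3≤n n-odd _ _ c-small with odd⇒≡3+a*2 3≤n n-odd
... | a , refl rewrite [n+3]/2 a = labeling , (labeling , constant≡) , minimal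
  where
  open Construction (suc a) k c using (labeling)
  constant≡ : SEMTLabeling.const labeling ≡ 2 * (3 + a * 2) * (k + 1) + 2 * c + (3 + a)
  constant≡ = rearrange a k c
    where
    rearrange : ∀ a k c → let P = (3 + a * 2) * (k + 1) + c in
                P + P + suc a + 2 ≡ 2 * (3 + a * 2) * (k + 1) + 2 * c + (3 + a)
    rearrange = solve-∀
  minimal : ∀ L → 2 * (3 + a * 2) * (k + 1) + 2 * c + (3 + a) ≤ SEMTLabeling.const L
  minimal L = countingBound⇒const-≥ a k c _ c-small (LowerBound.countingBound (2 + a * 2) k c L)
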